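{- Let $r\ge 3$ be an integer. Every $\mathrm{T}_{r}$-free $r$-graph $\mathcal{H}$ with $\delta_{r-1}^{+}(\mathcal{H}) \ge r$ is also $\Sigma_{r}$-free, i.e. there do not exist edges $A,B,C\in\mathcal{H}$ with $|A\cap B| = r-1$ and $A\triangle B \subseteq C$.
   Context: An $r$-graph $\mathcal{H}$ is a collection of $r$-subsets (edges) of a finite vertex set. $\mathrm{T}_{r} = \{\{1,\ldots,r-1,r\},\{1,\ldots,r-1,r+1\},\{r,r+1,\ldots,2r-1\}\}$; $\mathcal{H}$ is $\mathrm{T}_r$-free if it contains no copy of $\mathrm{T}_r$. $\Sigma_r$ is the family of $r$-graphs consisting of three edges $A,B,C$ with $|A\cap B|=r-1$ and symmetric difference $A\triangle B\subseteq C$. The shadow $\partial\mathcal{H}$ is the set of $(r-1)$-sets contained in some edge; for $e\in\partial\mathcal{H}$, $N_{\mathcal{H}}(e)=\{v : e\cup\{v\}\in\mathcal{H}\}$, and $\delta_{r-1}^{+}(\mathcal{H}) = \min\{|N_{\mathcal{H}}(e)| : e\in\partial\mathcal{H}\}$. -}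

module Defs where

open import Data.Nat using (ℕ; _<_; _≤_; _∸_; _+_; _*_)
open import Data.Bool using (Bool)
open import Data.Fin using (Fin; toℕ)
open import Data.Fin.Subset using (Subset; _∈_; _⊆_; _∩_; _∪_; _─_; ∣_∣; ⁅_⁆)
open import Data.Vec using (tabulate)
open import Data.Vec.Properties using (≡-dec)
open import Data.Bool.Properties using () renaming (_≟_ to _≟ᵇ_)
open import Data.List using (List)
open import Data.List.Relation.Unary.All using (All)
import Data.List.Membership.Propositional as LM
open import Data.List.Relation.Unary.Any using (any?)
open import Data.Product using (Σ; ∃; _×_; _,_)
open import Data.Sum using (_⊎_)
open import Relation.Binary.PropositionalEquality using (_≡_)
open import Relation.Nullary using (¬_; Dec)
open import Relation.Nullary.Decidable using (isYes)
open import Function.Definitions using (Injective)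

-- An r-graph on the vertex set Fin n: a finite list of r-subsets (edges).
-- (Repetitions in the list are harmless: only membership matters.)
record RGraph (r n : ℕ) : Set where
  field
    edges   : List (Subset n)
    uniform : All (λ e → ∣ e ∣ ≡ r) edges
open RGraph public

_∈ᴱ_ : ∀ {r n} → Subset n → RGraph r n → Set
E ∈ᴱ H = E LM.∈ edges H

_≟ˢ_ : ∀ {n} (x y : Subset n) → Dec (x ≡ y)
_≟ˢ_ = ≡-dec _≟ᵇ_

InShadow : ∀ {r n} → RGraph r n → Subset n → Set
InShadow {r} H e = ∣ e ∣ ≡ r ∸ 1 × Σ (Subset _) (λ E → E ∈ᴱ H × e ⊆ E)

Nbhd : ∀ {r n} → RGraph r n → Subset n → Subset n
Nbhd H e = tabulate (λ v → isYes (any? (λ E → (e ∪ ⁅ v ⁆) ≟ˢ E) (edges H)))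

MinPosCodegree≥ : ∀ {r n} → RGraph r n → ℕ → Set
MinPosCodegree≥ H d = ∀ e → InShadow H e → d ≤ ∣ Nbhd H e ∣

-- T_r on vertex set {1,…,2r-1}, represented as Fin (2r-1) with i ↦ toℕ i + 1.
-- Edges: {1..r}, {1..r-1, r+1}, {r..2r-1}.
Tr-edge₁ Tr-edge₂ Tr-edge₃ : (r : ℕ) → Fin (2 * r ∸ 1) → Set
Tr-edge₁ r i = toℕ i < r
Tr-edge₂ r i = toℕ i < r ∸ 1 ⊎ toℕ i ≡ r
Tr-edge₃ r i = r ∸ 1 ≤ toℕ i

ImageIs : ∀ {m n} → (Fin m → Fin n) → (Fin m → Set) → Subset n → Set
ImageIs {m} f P E = ∀ v → (v ∈ E → Σ (Fin m) (λ i → P i × f i ≡ v))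
                        × (∀ i → P i → f i ≡ v → v ∈ E)

ContainsTr : ∀ {r n} → RGraph r n → Set
ContainsTr {r} {n} H =
  Σ (Fin (2 * r ∸ 1) → Fin n) λ f → Injective _≡_ _≡_ f ×
    (Σ (Subset n) λ E → E ∈ᴱ H × ImageIs f (Tr-edge₁ r) E) ×
    (Σ (Subset n) λ E → E ∈ᴱ H × ImageIs f (Tr-edge₂ r) E) ×
    (Σ (Subset n) λ E → E ∈ᴱ H × ImageIs f (Tr-edge₃ r) E)

TrFree : ∀ {r n} → RGraph r n → Set
TrFree H = ¬ ContainsTr H

ΣrFree : ∀ {r n} → RGraph r n → Set
ΣrFree {r} {n} H =
  ¬ (Σ (Subset n) λ A → Σ (Subset n) λ B → Σ (Subset n) λ C →
       A ∈ᴱ H × B ∈ᴱ H × C ∈ᴱ H ×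
       ∣ A ∩ B ∣ ≡ r ∸ 1 × ((A ─ B) ∪ (B ─ A)) ⊆ C)

-- Let A, B, C be edges with |A ∩ B| = r-1 and A △ B = {a, b} ⊆ C, and put S = A ∩ B.
-- While C meets S, remove some s ∈ C ∩ S: the (r-1)-set C - s lies in the shadow, so it
-- has at least r > |S| neighbours, one of them outside S, and adding it gives an edge
-- that still contains a and b but meets S in fewer vertices.  The final edge C' is
-- disjoint from S and contains a and b, so A = S ∪ {a}, B = S ∪ {b}, C' form a copy of T_r.
module Submission where

open import Defs
open import Data.Nat using (ℕ; zero; suc; _+_; _∸_; _*_; _<_; _≤_; s≤s; s≤s⁻¹)
open import Data.Nat.Properties
open import Data.Nat.Induction using (<-wellFounded)
open import Induction.WellFounded using (Acc; acc)
open import Data.Bool using (true; false)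
open import Data.Bool.Properties using (T-≡)
open import Data.Fin using (Fin; zero; suc; toℕ; cast; join; splitAt; _↑ˡ_)
import Data.Fin.Properties as Fin
open import Data.Fin.Subset
  using (Subset; _∈_; _∉_; _⊆_; _∩_; _∪_; _─_; _-_; ∣_∣; ⁅_⁆; ⊥; Empty; Nonempty; inside; outside)
open import Data.Fin.Subset.Properties
open import Data.Vec using ([]; _∷_; here; there)
open import Data.Vec.Properties using (lookup∘tabulate; []=⇒lookup)
import Data.Vec.Functional as Vector
open import Data.List.Relation.Unary.All as All using ()
open import Data.List.Relation.Unary.Any using (any?)
open import Data.Product using (∃; _×_; _,_; proj₁; proj₂; map; map₂)
open import Data.Sum using (_⊎_; inj₁; inj₂; [_,_])
open import Data.Empty using (⊥-elim)
open import Function using (_∘_)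
open import Function.Bundles using (Equivalence)
open import Function.Definitions using (Injective)
open import Relation.Nullary using (yes; no)
open import Relation.Nullary.Decidable using (toWitness)
open import Relation.Binary.PropositionalEquality
  using (_≡_; _≢_; refl; sym; trans; cong; subst; module ≡-Reasoning)

x∈p─q⇒x∉q : ∀ {n} (p q : Subset n) {x} → x ∈ p ─ q → x ∉ q
x∈p─q⇒x∉q (_ ∷ p) (true  ∷ q) (there x∈p─q) (there x∈q) = x∈p─q⇒x∉q p q x∈p─q x∈q
x∈p─q⇒x∉q (_ ∷ p) (false ∷ q) (there x∈p─q) (there x∈q) = x∈p─q⇒x∉q p q x∈p─q x∈q

p≡p∩q∪p─q : ∀ {n} (p q : Subset n) → p ≡ (p ∩ q) ∪ (p ─ q)
p≡p∩q∪p─q []          []          = refl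
p≡p∩q∪p─q (true  ∷ p) (true  ∷ q) = cong (inside ∷_) (p≡p∩q∪p─q p q)
p≡p∩q∪p─q (true  ∷ p) (false ∷ q) = cong (inside ∷_) (p≡p∩q∪p─q p q)
p≡p∩q∪p─q (false ∷ p) (true  ∷ q) = cong (outside ∷_) (p≡p∩q∪p─q p q)
p≡p∩q∪p─q (false ∷ p) (false ∷ q) = cong (outside ∷_) (p≡p∩q∪p─q p q)

∣p∣≡∣p∩q∣+∣p─q∣ : ∀ {n} (p q : Subset n) → ∣ p ∣ ≡ ∣ p ∩ q ∣ + ∣ p ─ q ∣
∣p∣≡∣p∩q∣+∣p─q∣ []          []          = refl
∣p∣≡∣p∩q∣+∣p─q∣ (true  ∷ p) (true  ∷ q) = cong suc (∣p∣≡∣p∩q∣+∣p─q∣ p q)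
∣p∣≡∣p∩q∣+∣p─q∣ (true  ∷ p) (false ∷ q) =
  trans (cong suc (∣p∣≡∣p∩q∣+∣p─q∣ p q)) (sym (+-suc _ _))
∣p∣≡∣p∩q∣+∣p─q∣ (false ∷ p) (true  ∷ q) = ∣p∣≡∣p∩q∣+∣p─q∣ p q
∣p∣≡∣p∩q∣+∣p─q∣ (false ∷ p) (false ∷ q) = ∣p∣≡∣p∩q∣+∣p─q∣ p q

∣p∣≡1+∣p-x∣ : ∀ {n} (p : Subset n) {x} → x ∈ p → ∣ p ∣ ≡ suc ∣ p - x ∣
∣p∣≡1+∣p-x∣ (true  ∷ p) here       = cong (suc ∘ ∣_∣) (sym (p─⊥≡p p))
∣p∣≡1+∣p-x∣ (true  ∷ p) (there x∈p) = cong suc (∣p∣≡1+∣p-x∣ p x∈p)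
∣p∣≡1+∣p-x∣ (false ∷ p) (there x∈p) = ∣p∣≡1+∣p-x∣ p x∈p

∣p∣≡0⇒p≡⊥ : ∀ {n} (p : Subset n) → ∣ p ∣ ≡ 0 → p ≡ ⊥
∣p∣≡0⇒p≡⊥ []          _  = refl
∣p∣≡0⇒p≡⊥ (false ∷ p) eq = cong (outside ∷_) (∣p∣≡0⇒p≡⊥ p eq)

∣p∣≡1⇒p≡⁅x⁆ : ∀ {n} (p : Subset n) → ∣ p ∣ ≡ 1 → ∃ λ x → p ≡ ⁅ x ⁆
∣p∣≡1⇒p≡⁅x⁆ (true  ∷ p) eq = zero , cong (inside ∷_) (∣p∣≡0⇒p≡⊥ p (suc-injective eq))
∣p∣≡1⇒p≡⁅x⁆ (false ∷ p) eq =
  let (x , p≡⁅x⁆) = ∣p∣≡1⇒p≡⁅x⁆ p eq in suc x , cong (outside ∷_) p≡⁅x⁆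

∣q∣<∣p∣⇒Nonempty[p─q] : ∀ {n} (p q : Subset n) → ∣ q ∣ < ∣ p ∣ → Nonempty (p ─ q)
∣q∣<∣p∣⇒Nonempty[p─q] (true  ∷ p) (false ∷ q) _  = zero , here
∣q∣<∣p∣⇒Nonempty[p─q] (true  ∷ p) (true  ∷ q) lt =
  map suc there (∣q∣<∣p∣⇒Nonempty[p─q] p q (s≤s⁻¹ lt))
∣q∣<∣p∣⇒Nonempty[p─q] (false ∷ p) (true  ∷ q) lt =
  map suc there (∣q∣<∣p∣⇒Nonempty[p─q] p q (<-trans (n<1+n _) lt))
∣q∣<∣p∣⇒Nonempty[p─q] (false ∷ p) (false ∷ q) lt =
  map suc there (∣q∣<∣p∣⇒Nonempty[p─q] p q lt)

record Enumeration {n} (X : Subset n) (m : ℕ) : Set where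
  field
    elem            : Fin m → Fin n
    elem-injective  : Injective _≡_ _≡_ elem
    elem∈           : ∀ i → elem i ∈ X
    elem-surjective : ∀ {x} → x ∈ X → ∃ λ i → elem i ≡ x
open Enumeration

enumeration-∷ : ∀ {n m} {X : Subset n} → Enumeration X m → Enumeration (outside ∷ X) m
enumeration-∷ e = record
  { elem            = suc ∘ elem e
  ; elem-injective  = elem-injective e ∘ Fin.suc-injective
  ; elem∈           = there ∘ elem∈ e
  ; elem-surjective = λ { (there x∈X) → map₂ (cong suc) (elem-surjective e x∈X) }
  }

enumeration-cons : ∀ {n m} {X : Subset n} {x} →
                   x ∈ X → Enumeration (X - x) m → Enumeration X (suc m)
enumeration-cons {X = X} {x} x∈X e = record
  { elem            = x Vector.∷ elem e
  ; elem-injective  = injective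
  ; elem∈           = λ { zero → x∈X ; (suc i) → p─q⊆p X ⁅ x ⁆ (elem∈ e i) }
  ; elem-surjective = surjective
  }
  where
  elem≢x : ∀ i → elem e i ≢ x
  elem≢x i = x∉⁅y⁆⇒x≢y (x∈p─q⇒x∉q X ⁅ x ⁆ (elem∈ e i))

  injective : Injective _≡_ _≡_ (x Vector.∷ elem e)
  injective {zero}  {zero}  _  = refl
  injective {zero}  {suc j} eq = ⊥-elim (elem≢x j (sym eq))
  injective {suc i} {zero}  eq = ⊥-elim (elem≢x i eq)
  injective {suc i} {suc j} eq = cong suc (elem-injective e eq)

  surjective : ∀ {y} → y ∈ X → ∃ λ i → (x Vector.∷ elem e) i ≡ y
  surjective {y} y∈X with y Fin.≟ x
  ... | yes refl = zero , refl
  ... | no  y≢x  = map suc (λ eq → eq) (elem-surjective e (x∈p∧x≢y⇒x∈p-y y∈X y≢x))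

enumerate : ∀ {n} (X : Subset n) → Enumeration X ∣ X ∣
enumerate []          = record
  { elem = λ () ; elem-injective = λ { {()} } ; elem∈ = λ () ; elem-surjective = λ () }
enumerate (false ∷ X) = enumeration-∷ (enumerate X)
enumerate (true  ∷ X) = enumeration-cons here
  (subst (λ Y → Enumeration (outside ∷ Y) ∣ X ∣) (sym (p─⊥≡p X)) (enumeration-∷ (enumerate X)))

enumerate-of-size : ∀ {n m} (X : Subset n) → ∣ X ∣ ≡ m → Enumeration X m
enumerate-of-size X eq = subst (Enumeration X) eq (enumerate X)

p─q⊆p-x : ∀ {n} (p q : Subset n) {x} → x ∈ q → p ─ q ⊆ p - x
p─q⊆p-x p q x∈q y∈p─q = x∈p∧x≢y⇒x∈p-y (p─q⊆p p q y∈p─q) λ { refl → x∈p─q⇒x∉q p q y∈p─q x∈q }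

[p-x∪⁅y⁆]∩q⊆[p∩q]-x : ∀ {n} (p q : Subset n) (x : Fin n) {y} →
                       y ∉ q → ((p - x) ∪ ⁅ y ⁆) ∩ q ⊆ (p ∩ q) - x
[p-x∪⁅y⁆]∩q⊆[p∩q]-x p q x {y} y∉q z∈ with x∈p∩q⁻ _ q z∈
... | z∈p-x∪⁅y⁆ , z∈q with x∈p∪q⁻ (p - x) ⁅ y ⁆ z∈p-x∪⁅y⁆
... | inj₁ z∈p-x = x∈p∧x≢y⇒x∈p-y (x∈p∩q⁺ (p─q⊆p p ⁅ x ⁆ z∈p-x , z∈q))
                                  (x∉⁅y⁆⇒x≢y (x∈p─q⇒x∉q p ⁅ x ⁆ z∈p-x))
... | inj₂ z∈⁅y⁆ = ⊥-elim (y∉q (subst (_∈ q) (x∈⁅y⁆⇒x≡y y z∈⁅y⁆) z∈q))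

edge-size : ∀ {r n} (H : RGraph r n) {E} → E ∈ᴱ H → ∣ E ∣ ≡ r
edge-size H = All.lookup (uniform H)

∈Nbhd⇒edge : ∀ {r n} (H : RGraph r n) {e v} → v ∈ Nbhd H e → (e ∪ ⁅ v ⁆) ∈ᴱ H
∈Nbhd⇒edge H {e} {v} v∈N = toWitness {a? = any? (λ E → (e ∪ ⁅ v ⁆) ≟ˢ E) (edges H)}
  (Equivalence.from T-≡ (trans (sym (lookup∘tabulate _ v)) ([]=⇒lookup v∈N)))

module _ {r n d} (H : RGraph r n) (codegree : MinPosCodegree≥ H d)
         {S : Subset n} (∣S∣<d : ∣ S ∣ < d) where

  exchange : ∀ {X s} → X ∈ᴱ H → s ∈ X → ∃ λ v → v ∉ S × ((X - s) ∪ ⁅ v ⁆) ∈ᴱ H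
  exchange {X} {s} X∈H s∈X =
    let (v , v∈N─S) = ∣q∣<∣p∣⇒Nonempty[p─q] (Nbhd H (X - s)) S (<-≤-trans ∣S∣<d d≤∣N∣)
    in v , x∈p─q⇒x∉q _ S v∈N─S , ∈Nbhd⇒edge H (p─q⊆p _ S v∈N─S)
    where
    ∣X-s∣≡r-1 : ∣ X - s ∣ ≡ r ∸ 1
    ∣X-s∣≡r-1 = cong (_∸ 1) (trans (sym (∣p∣≡1+∣p-x∣ X s∈X)) (edge-size H X∈H))

    d≤∣N∣ : d ≤ ∣ Nbhd H (X - s) ∣
    d≤∣N∣ = codegree (X - s) (∣X-s∣≡r-1 , X , X∈H , p─q⊆p X ⁅ s ⁆)

  edge-avoiding : ∀ {X} → X ∈ᴱ H → ∃ λ Y → Y ∈ᴱ H × X ─ S ⊆ Y × Empty (Y ∩ S)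
  edge-avoiding X∈H = go (<-wellFounded _) X∈H
    where
    go : ∀ {X} → Acc _<_ ∣ X ∩ S ∣ → X ∈ᴱ H → ∃ λ Y → Y ∈ᴱ H × X ─ S ⊆ Y × Empty (Y ∩ S)
    go {X} (acc rec) X∈H with nonempty? (X ∩ S)
    ... | no  X∩S-empty = X , X∈H , p─q⊆p X S , X∩S-empty
    ... | yes (s , s∈X∩S) =
      let (s∈X , s∈S)                   = x∈p∩q⁻ X S s∈X∩S
          (v , v∉S , Y∈H)               = exchange X∈H s∈X
          smaller : ∣ ((X - s) ∪ ⁅ v ⁆) ∩ S ∣ < ∣ X ∩ S ∣
          smaller = ≤-<-trans (p⊆q⇒∣p∣≤∣q∣ ([p-x∪⁅y⁆]∩q⊆[p∩q]-x X S s v∉S)) (x∈p⇒∣p-x∣<∣p∣ s∈X∩S)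
          (Z , Z∈H , Y─S⊆Z , Z∩S-empty) = go (rec smaller) Y∈H
          X─S⊆Y : X ─ S ⊆ (X - s) ∪ ⁅ v ⁆
          X─S⊆Y = p⊆p∪q ⁅ v ⁆ ∘ p─q⊆p-x X S s∈S
      in Z , Z∈H , (λ x∈X─S → Y─S⊆Z (x∈p∧x∉q⇒x∈p─q (X─S⊆Y x∈X─S) (x∈p─q⇒x∉q X S x∈X─S)))
       , Z∩S-empty

-- The vertices 1, …, 2r-1 of T_r (r = suc p) split as p + r: slot inj₁ j is vertex j of the
-- shared (r-1)-set, slot inj₂ j is vertex j of the third edge {r, …, 2r-1}.
module Layout (p : ℕ) where

  Slot : Set
  Slot = Fin p ⊎ Fin (suc p)

  position : Slot → ℕ
  position = [ toℕ , (p +_) ∘ toℕ ]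

  private
    size : p + suc p ≡ 2 * suc p ∸ 1
    size = cong (λ m → p + suc m) (sym (+-identityʳ p))

  index : Slot → Fin (2 * suc p ∸ 1)
  index = cast size ∘ join p (suc p)

  slot : Fin (2 * suc p ∸ 1) → Slot
  slot = splitAt p ∘ cast (sym size)

  toℕ-index : ∀ x → toℕ (index x) ≡ position x
  toℕ-index (inj₁ j) = trans (Fin.toℕ-cast size (j ↑ˡ suc p)) (Fin.toℕ-↑ˡ j (suc p))
  toℕ-index (inj₂ j) = trans (Fin.toℕ-cast size _) (Fin.toℕ-↑ʳ p j)

  index-slot : ∀ i → index (slot i) ≡ i
  index-slot i = begin
    index (slot i)                ≡⟨ cong (cast size) (Fin.join-splitAt p (suc p) _) ⟩
    cast size (cast (sym size) i) ≡⟨ Fin.cast-involutive size (sym size) i ⟩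
    i                             ∎
    where open ≡-Reasoning

  slot-index : ∀ x → slot (index x) ≡ x
  slot-index x = begin
    slot (index x)               ≡⟨ cong (splitAt p) (Fin.cast-involutive (sym size) size _) ⟩
    splitAt p (join p (suc p) x) ≡⟨ Fin.splitAt-join p (suc p) x ⟩
    x                            ∎
    where open ≡-Reasoning

  slot-injective : Injective _≡_ _≡_ slot
  slot-injective {i} {j} eq = trans (sym (index-slot i)) (trans (cong index eq) (index-slot j))

  imageIs-slot : ∀ {n} {g : Slot → Fin n} (Q : ℕ → Set) {E : Subset n} →
                 (∀ {v} → v ∈ E → ∃ λ x → Q (position x) × g x ≡ v) →
                 (∀ x → Q (position x) → g x ∈ E) →
                 ImageIs (g ∘ slot) (Q ∘ toℕ) E
  imageIs-slot {g = g} Q {E} covered within v =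
    (λ v∈E → let (x , Qx , gx≡v) = covered v∈E in
       index x , subst Q (sym (toℕ-index x)) Qx , trans (cong g (slot-index x)) gx≡v) ,
    (λ i Qi g[slot-i]≡v → subst (_∈ E) g[slot-i]≡v
       (within (slot i) (subst Q (trans (cong toℕ (sym (index-slot i))) (toℕ-index (slot i))) Qi)))

module _ {k n} {H : RGraph (suc (suc k)) n} {S C : Subset n}
         (eS : Enumeration S (suc k)) (eC : Enumeration C (suc (suc k)))
         (S∩C-empty : Empty (S ∩ C)) where

  open Layout (suc k)

  private
    a b : Fin n
    a = elem eC zero
    b = elem eC (suc zero)

    g : Slot → Fin n
    g = [ elem eS , elem eC ]

    separated : ∀ i j → elem eS i ≢ elem eC j
    separated i j eq = S∩C-empty (_ , x∈p∩q⁺ (elem∈ eS i , subst (_∈ C) (sym eq) (elem∈ eC j)))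

    g-injective : Injective _≡_ _≡_ g
    g-injective {inj₁ i} {inj₁ j} eq = cong inj₁ (elem-injective eS eq)
    g-injective {inj₁ i} {inj₂ j} eq = ⊥-elim (separated i j eq)
    g-injective {inj₂ i} {inj₁ j} eq = ⊥-elim (separated j i (sym eq))
    g-injective {inj₂ i} {inj₂ j} eq = cong inj₂ (elem-injective eC eq)

    covered₁ : ∀ {v} → v ∈ S ∪ ⁅ a ⁆ → ∃ λ x → position x < suc (suc k) × g x ≡ v
    covered₁ {v} v∈ with x∈p∪q⁻ S ⁅ a ⁆ v∈
    ... | inj₁ v∈S = let (j , eq) = elem-surjective eS v∈S in inj₁ j , m<n⇒m<1+n (Fin.toℕ<n j) , eq
    ... | inj₂ v∈⁅a⁆ = inj₂ zero , s≤s (≤-reflexive (+-identityʳ (suc k))) , sym (x∈⁅y⁆⇒x≡y a v∈⁅a⁆)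

    within₁ : ∀ x → position x < suc (suc k) → g x ∈ S ∪ ⁅ a ⁆
    within₁ (inj₁ j)       _  = p⊆p∪q ⁅ a ⁆ (elem∈ eS j)
    within₁ (inj₂ zero)    _  = q⊆p∪q S ⁅ a ⁆ (x∈⁅x⁆ a)
    within₁ (inj₂ (suc j)) lt = ⊥-elim (m+1+n≰m (suc k) (s≤s⁻¹ lt))

    covered₂ : ∀ {v} → v ∈ S ∪ ⁅ b ⁆ →
               ∃ λ x → (position x < suc k ⊎ position x ≡ suc (suc k)) × g x ≡ v
    covered₂ {v} v∈ with x∈p∪q⁻ S ⁅ b ⁆ v∈
    ... | inj₁ v∈S = let (j , eq) = elem-surjective eS v∈S in inj₁ j , inj₁ (Fin.toℕ<n j) , eq
    ... | inj₂ v∈⁅b⁆ = inj₂ (suc zero) , inj₂ (+-comm (suc k) 1) , sym (x∈⁅y⁆⇒x≡y b v∈⁅b⁆)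

    within₂ : ∀ x → position x < suc k ⊎ position x ≡ suc (suc k) → g x ∈ S ∪ ⁅ b ⁆
    within₂ (inj₁ j) _          = p⊆p∪q ⁅ b ⁆ (elem∈ eS j)
    within₂ (inj₂ j) (inj₁ lt)  = ⊥-elim (m+n≮m (suc k) (toℕ j) lt)
    within₂ (inj₂ j) (inj₂ eq)  =
      subst (λ i → elem eC i ∈ S ∪ ⁅ b ⁆) (sym j≡1) (q⊆p∪q S ⁅ b ⁆ (x∈⁅x⁆ b))
      where
      j≡1 : j ≡ suc zero
      j≡1 = Fin.toℕ-injective (+-cancelˡ-≡ (suc k) (toℕ j) 1 (trans eq (+-comm 1 (suc k))))

    covered₃ : ∀ {v} → v ∈ C → ∃ λ x → suc k ≤ position x × g x ≡ v
    covered₃ v∈C = let (j , eq) = elem-surjective eC v∈C in inj₂ j , m≤m+n (suc k) (toℕ j) , eq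

    within₃ : ∀ x → suc k ≤ position x → g x ∈ C
    within₃ (inj₁ j) le = ⊥-elim (<⇒≱ (Fin.toℕ<n j) le)
    within₃ (inj₂ j) _  = elem∈ eC j

  containsTr : (S ∪ ⁅ elem eC zero ⁆) ∈ᴱ H → (S ∪ ⁅ elem eC (suc zero) ⁆) ∈ᴱ H → C ∈ᴱ H →
               ContainsTr H
  containsTr A∈H B∈H C∈H =
    g ∘ slot , (λ eq → slot-injective (g-injective eq)) ,
    (_ , A∈H , imageIs-slot (_< suc (suc k)) covered₁ within₁) ,
    (_ , B∈H , imageIs-slot (λ m → m < suc k ⊎ m ≡ suc (suc k)) covered₂ within₂) ,
    (_ , C∈H , imageIs-slot (suc k ≤_) covered₃ within₃)

module _ {k n} (H : RGraph (suc (suc k)) n) where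

  private
    edge≡[edge∩Y]∪⁅x⁆ : ∀ {X Y} → X ∈ᴱ H → ∣ X ∩ Y ∣ ≡ suc k →
                        ∃ λ x → x ∈ X ─ Y × X ≡ (X ∩ Y) ∪ ⁅ x ⁆
    edge≡[edge∩Y]∪⁅x⁆ {X} {Y} X∈H ∣X∩Y∣≡ =
      let (x , X─Y≡⁅x⁆) = ∣p∣≡1⇒p≡⁅x⁆ (X ─ Y) ∣X─Y∣≡1
      in x , subst (x ∈_) (sym X─Y≡⁅x⁆) (x∈⁅x⁆ x) , trans (p≡p∩q∪p─q X Y) (cong (X ∩ Y ∪_) X─Y≡⁅x⁆)
      where
      open ≡-Reasoning
      ∣X─Y∣≡1 : ∣ X ─ Y ∣ ≡ 1
      ∣X─Y∣≡1 = +-cancelˡ-≡ (suc k) _ 1 (begin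
        suc k + ∣ X ─ Y ∣     ≡⟨ cong (_+ ∣ X ─ Y ∣) ∣X∩Y∣≡ ⟨
        ∣ X ∩ Y ∣ + ∣ X ─ Y ∣ ≡⟨ ∣p∣≡∣p∩q∣+∣p─q∣ X Y ⟨
        ∣ X ∣                 ≡⟨ edge-size H X∈H ⟩
        suc (suc k)           ≡⟨ +-comm 1 (suc k) ⟩
        suc k + 1             ∎)

  ΣrFree-if-TrFree : TrFree H → MinPosCodegree≥ H (suc (suc k)) → ΣrFree H
  ΣrFree-if-TrFree Tr-free codegree (A , B , C , A∈H , B∈H , C∈H , ∣A∩B∣≡ , A△B⊆C)
    with edge≡[edge∩Y]∪⁅x⁆ A∈H ∣A∩B∣≡ | edge≡[edge∩Y]∪⁅x⁆ B∈H (trans (cong ∣_∣ (∩-comm B A)) ∣A∩B∣≡)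
  ... | a , a∈A─B , A≡S∪⁅a⁆ | b , b∈B─A , B≡B∩A∪⁅b⁆
    with edge-avoiding H codegree (≤-reflexive (cong suc ∣A∩B∣≡)) C∈H
  ... | C′ , C′∈H , C─S⊆C′ , C′∩S-empty =
    Tr-free (containsTr {H = H} eS eC (subst Empty (∩-comm C′ S) C′∩S-empty)
               (subst (_∈ᴱ H) A≡S∪⁅a⁆ A∈H)
               (subst (_∈ᴱ H) (trans B≡B∩A∪⁅b⁆ (cong (_∪ ⁅ b ⁆) (∩-comm B A))) B∈H)
               C′∈H)
    where
    S = A ∩ B

    a∈C′ : a ∈ C′
    a∈C′ = C─S⊆C′ (x∈p∧x∉q⇒x∈p─q (A△B⊆C (x∈p∪q⁺ (inj₁ a∈A─B)))
                      (x∈p─q⇒x∉q A B a∈A─B ∘ proj₂ ∘ x∈p∩q⁻ A B))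
    b∈C′-a : b ∈ C′ - a
    b∈C′-a = x∈p∧x≢y⇒x∈p-y
      (C─S⊆C′ (x∈p∧x∉q⇒x∈p─q (A△B⊆C (x∈p∪q⁺ (inj₂ b∈B─A)))
                 (x∈p─q⇒x∉q B A b∈B─A ∘ proj₁ ∘ x∈p∩q⁻ A B)))
      (λ { refl → x∈p─q⇒x∉q A B a∈A─B (p─q⊆p B A b∈B─A) })

    ∣C′-a-b∣ : ∣ C′ - a - b ∣ ≡ k
    ∣C′-a-b∣ = suc-injective (suc-injective (begin
      suc (suc ∣ C′ - a - b ∣) ≡⟨ cong suc (∣p∣≡1+∣p-x∣ (C′ - a) b∈C′-a) ⟨
      suc ∣ C′ - a ∣           ≡⟨ ∣p∣≡1+∣p-x∣ C′ a∈C′ ⟨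
      ∣ C′ ∣                   ≡⟨ edge-size H C′∈H ⟩
      suc (suc k)              ∎))
      where open ≡-Reasoning

    eS : Enumeration S (suc k)
    eS = enumerate-of-size S ∣A∩B∣≡
    eC : Enumeration C′ (suc (suc k))
    eC = enumeration-cons a∈C′ (enumeration-cons b∈C′-a (enumerate-of-size (C′ - a - b) ∣C′-a-b∣))

proposition2p1 : (r n : ℕ) → 3 ≤ r → (H : RGraph r n) →
    TrFree H → MinPosCodegree≥ H r → ΣrFree H
proposition2p1 (suc (suc (suc _))) _ _ H = ΣrFree-if-TrFree H
proposition2p1 1 _ (s≤s ())
proposition2p1 2 _ (s≤s (s≤s ()))
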